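{- For every $n\ge 3$ there exists an infinite square-free $C_n$-word. Moreover, $\gamma(C_3)=3$ and $\gamma(C_4)=4$.
   Context: $C_n$ is the cycle on $\{0,\ldots,n-1\}$ with edges $i(i+1)$, indices mod $n$. A finite or infinite word over the vertex set is a $C_n$-word if each consecutive pair of letters is an edge. A word is square-free if it has no factor $uu$ with $u$ nonempty. For a graph $G$, $\gamma(G)$ is the smallest $k$ such that there exist an infinite $G$-word $w$ and a map $\varphi$ from the vertices to $\{0,\ldots,k-1\}$ (extended letterwise) with $\varphi(w)$ square-free. -}

module Defs where

open import Data.Nat using (ℕ; zero; suc; _+_; _<_; _≤_; NonZero)
open import Data.Nat.DivMod using (_%_)
open import Data.Fin using (Fin; toℕ)
open import Data.Product using (Σ; _×_; ∃-syntax)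
open import Data.Sum using (_⊎_)
open import Relation.Binary.PropositionalEquality using (_≡_)
open import Relation.Nullary using (¬_)

record Graph : Set₁ where
  field
    size : ℕ
    Adj  : Fin size → Fin size → Set
open Graph public

CycleAdj : (n : ℕ) → .{{NonZero n}} → Fin n → Fin n → Set
CycleAdj n i j = (toℕ j ≡ (toℕ i + 1) % n) ⊎ (toℕ i ≡ (toℕ j + 1) % n)

C : (n : ℕ) → .{{NonZero n}} → Graph
C n = record { size = n ; Adj = CycleAdj n }

IsGWord : (G : Graph) → (ℕ → Fin (size G)) → Set
IsGWord G w = ∀ i → Adj G (w i) (w (suc i))

SquareFree : {A : Set} → (ℕ → A) → Set
SquareFree w = ¬ (Σ ℕ λ i → Σ ℕ λ l → (1 ≤ l) × (∀ k → k < l → w (i + k) ≡ w (i + l + k)))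

Achievable : Graph → ℕ → Set
Achievable G k = Σ (ℕ → Fin (size G)) λ w → IsGWord G w ×
                 Σ (Fin (size G) → Fin k) λ φ → SquareFree (λ i → φ (w i))

GammaIs : Graph → ℕ → Set
GammaIs G k = Achievable G k × (∀ m → m < k → ¬ Achievable G m)

-- A uniform morphism h with blocks of length m sends square-free words to
-- square-free words as soon as (i) no block h(c) occurs inside h(a)h(b) at an
-- offset 0 < p < m, (ii) blocks are told apart by their letter at one fixed
-- position, and (iii) the image of a square-free word of length at most 5 has
-- no square of half-length below 2m starting in its first block.  By (i) a
-- longer square has a half-length divisible by m, and reading position (ii) of
-- its blocks pulls it back to a square of the preimage; a shorter square lies
-- inside the image of five consecutive letters, where (iii) excludes it.  All
-- three conditions are finite and are checked by evaluation.
--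
-- Leech's 13-uniform morphism gives a square-free ternary word, which is a
-- walk on C₃ since consecutive letters differ.  A 9-uniform morphism on four
-- letters has a square-free fixed point walking on C₄, and 8- and 14-uniform
-- images of Leech's word walk on C₅ and on the path 0 – 1 – ⋯ – 5, hence on
-- every Cₙ with n ≥ 6.  Conversely, every word over two letters has a square
-- among its first four letters, and a pruned exhaustive search shows that
-- every walk on C₄ coloured with three colours has a square among its first
-- sixteen letters.

module Submission where

open import Defs
open import Data.Bool using (Bool; true; false; T)
open import Data.Empty using (⊥)
open import Data.Fin using (Fin; zero; suc; toℕ; inject≤; _↑ˡ_)
open import Data.Fin.Properties using (all?; inject≤-injective; toℕ<n; toℕ-↑ˡ; ↑ˡ-injective)
  renaming (_≟_ to _≟ᶠ_)
open import Data.List using (List; []; _∷_)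
open import Data.Bool.ListAction using (all)
open import Data.List.Membership.Propositional using (_∈_)
import Data.List.Membership.DecPropositional as DecMembership
import Data.List.Relation.Unary.All as All
open import Data.List.Relation.Unary.All.Properties using (all⁺)
open import Data.Nat
open import Data.Nat.Properties
open import Data.Nat.DivMod
open import Data.Nat.Divisibility using (_∣_; divides; m%n≡0⇒n∣m; ∣m+n∣m⇒∣n; n∣m*n)
open import Data.Nat.Tactic.RingSolver using (solve-∀)
open import Data.Product using (Σ; ∃-syntax; _×_; _,_; proj₁)
open import Data.Sum as Sum using (_⊎_)
open import Data.Vec using (Vec; []; _∷_; lookup; tabulate)
open import Data.Vec.Properties using (lookup∘tabulate)
open import Function using (id; _∘_)
open import Function.Definitions using (Injective)
open import Relation.Nullary
open import Relation.Nullary.Decidable using (True; toWitness; map′)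
open import Relation.Unary using (Decidable)
open import Relation.Binary.Definitions using (DecidableEquality)
open import Relation.Binary.PropositionalEquality

-- Squares in infinite words

IsSquareAt : {A : Set} → (ℕ → A) → ℕ → ℕ → Set
IsSquareAt w i l = 1 ≤ l × (∀ k → k < l → w (i + k) ≡ w (i + l + k))

SquareFreeWithin : {A : Set} → ℕ → (ℕ → A) → Set
SquareFreeWithin N w = ∀ i l → IsSquareAt w i l → i + l + l ≤ N → ⊥

module _ {A : Set} where

  isSquareAt-agree : ∀ {w w' : ℕ → A} {i l} → (∀ k → k < i + l + l → w k ≡ w' k) →
                     IsSquareAt w i l → IsSquareAt w' i l
  isSquareAt-agree {w} {w'} {i} {l} agree (1≤l , eq) = 1≤l , λ k k<l →
    trans (sym (agree (i + k) (first k k<l))) (trans (eq k k<l) (agree (i + l + k) (second k k<l)))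
    where
    first : ∀ k → k < l → i + k < i + l + l
    first k k<l = <-≤-trans (+-monoʳ-< i k<l) (m≤m+n (i + l) l)
    second : ∀ k → k < l → i + l + k < i + l + l
    second k k<l = +-monoʳ-< (i + l) k<l

  squareFree-resp-≗ : ∀ {w w' : ℕ → A} → w ≗ w' → SquareFree w → SquareFree w'
  squareFree-resp-≗ {w} {w'} w≗w' sf (i , l , sq) = sf (i , l , isSquareAt-agree {w = w'} (λ k _ → sym (w≗w' k)) sq)

  squareFree⇒squareFreeWithin : ∀ {w : ℕ → A} N → SquareFree w → SquareFreeWithin N w
  squareFree⇒squareFreeWithin N sf i l sq _ = sf (i , l , sq)

  squareFreeWithin⇒squareFree : ∀ {w : ℕ → A} → (∀ N → SquareFreeWithin N w) → SquareFree w
  squareFreeWithin⇒squareFree sf (i , l , sq) = sf (i + l + l) i l sq ≤-refl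

  squareFreeWithin-mono : ∀ {w : ℕ → A} {M N} → M ≤ N → SquareFreeWithin N w → SquareFreeWithin M w
  squareFreeWithin-mono M≤N sf i l sq bound = sf i l sq (≤-trans bound M≤N)

  squareFreeWithin-resp-≗ : ∀ {w w' : ℕ → A} {N} → w ≗ w' → SquareFreeWithin N w → SquareFreeWithin N w'
  squareFreeWithin-resp-≗ w≗w' sf i l sq = sf i l (isSquareAt-agree (λ k _ → sym (w≗w' k)) sq)

  squareFreeWithin-agree : ∀ {w w' : ℕ → A} {N} → (∀ k → k < N → w k ≡ w' k) →
                           SquareFreeWithin N w → SquareFreeWithin N w'
  squareFreeWithin-agree agree sf i l sq bound =
    sf i l (isSquareAt-agree (λ k k< → sym (agree k (<-≤-trans k< bound))) sq) bound

  drop : ℕ → (ℕ → A) → ℕ → A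
  drop j w k = w (j + k)

  isSquareAt-drop : ∀ {w : ℕ → A} n {i l} → IsSquareAt w (n + i) l → IsSquareAt (drop n w) i l
  isSquareAt-drop {w} n {i} {l} (1≤l , eq) = 1≤l , λ k k<l →
    subst₂ (λ x y → w x ≡ w y) (+-assoc n i k) (trans (cong (_+ k) (+-assoc n i l)) (+-assoc n (i + l) k)) (eq k k<l)

  squareFreeWithin-drop : ∀ {w : ℕ → A} {N} j c → j + c ≤ N →
                          SquareFreeWithin N w → SquareFreeWithin c (drop j w)
  squareFreeWithin-drop {w} {N} j c j+c≤N sf i l (1≤l , eq) bound =
    sf (j + i) l (1≤l , λ k k<l → subst₂ (λ x y → w x ≡ w y) (sym (+-assoc j i k)) (reassoc k) (eq k k<l))
       (begin
         j + i + l + l   ≡⟨ reassoc l ⟨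
         j + (i + l + l) ≤⟨ +-monoʳ-≤ j bound ⟩
         j + c           ≤⟨ j+c≤N ⟩
         N               ∎)
    where
    open ≤-Reasoning
    reassoc : ∀ k → j + (i + l + k) ≡ j + i + l + k
    reassoc k = sym (trans (cong (_+ k) (+-assoc j i l)) (+-assoc j (i + l) k))

  squareFree⇒adjacent-distinct : ∀ {w : ℕ → A} → SquareFree w → ∀ k → w k ≢ w (suc k)
  squareFree⇒adjacent-distinct {w} sf k wk≡wk+1 = sf (k , 1 , ≤-refl , λ { zero _ → wk≡wk+1′ ; (suc _) (s≤s ()) })
    where
    wk≡wk+1′ : w (k + 0) ≡ w (k + 1 + 0)
    wk≡wk+1′ = subst₂ (λ x y → w x ≡ w y) (sym (+-identityʳ k)) (sym (trans (+-identityʳ (k + 1)) (+-comm k 1))) wk≡wk+1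

squareFreeWithin-1 : {A : Set} {w : ℕ → A} → SquareFreeWithin 1 w
squareFreeWithin-1 i l (1≤l , _) bound with ≤-trans (+-mono-≤ 1≤l 1≤l) (≤-trans (+-monoˡ-≤ l (m≤n+m l i)) bound)
... | s≤s ()

squareFree-map : ∀ {A B : Set} {f : A → B} → Injective _≡_ _≡_ f →
                 ∀ {w : ℕ → A} → SquareFree w → SquareFree (f ∘ w)
squareFree-map f-inj sf (i , l , 1≤l , eq) = sf (i , l , 1≤l , λ k k<l → f-inj (eq k k<l))

≢-≢⇒≡-binary : (a b c : Fin 2) → a ≢ b → b ≢ c → a ≡ c
≢-≢⇒≡-binary zero zero _ a≢b _ = contradiction refl a≢b
≢-≢⇒≡-binary zero (suc zero) zero _ _ = refl
≢-≢⇒≡-binary zero (suc zero) (suc zero) _ b≢c = contradiction refl b≢c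
≢-≢⇒≡-binary (suc zero) zero zero _ b≢c = contradiction refl b≢c
≢-≢⇒≡-binary (suc zero) zero (suc zero) _ _ = refl
≢-≢⇒≡-binary (suc zero) (suc zero) _ a≢b _ = contradiction refl a≢b

binary-not-squareFree : (w : ℕ → Fin 2) → ¬ SquareFree w
binary-not-squareFree w sf = sf (0 , 2 , s≤s z≤n , λ { 0 _ → letter 0 ; 1 _ → letter 1 ; (suc (suc _)) (s≤s (s≤s ())) })
  where
  letter : ∀ k → w k ≡ w (2 + k)
  letter k = ≢-≢⇒≡-binary _ _ _ (squareFree⇒adjacent-distinct {w = w} sf k) (squareFree⇒adjacent-distinct {w = w} sf (suc k))

squareFree⇒3≤size : ∀ {m} (w : ℕ → Fin m) → SquareFree w → 3 ≤ m
squareFree⇒3≤size {m} w sf with 3 ≤? m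
... | yes 3≤m = 3≤m
... | no 3≰m = contradiction (squareFree-map (λ {i} {j} → inject≤-injective m≤2 m≤2 i j) {w} sf) (binary-not-squareFree (λ k → inject≤ (w k) m≤2))
  where
  m≤2 : m ≤ 2
  m≤2 = ≤-pred (≰⇒> 3≰m)

LinkedWithin : {A : Set} → (A → A → Set) → ℕ → (ℕ → A) → Set
LinkedWithin R N w = ∀ n → suc n < N → R (w n) (w (suc n))

module _ {A : Set} where

  prefix : (ℕ → A) → (c : ℕ) → Vec A c
  prefix w zero = []
  prefix w (suc c) = w 0 ∷ prefix (w ∘ suc) c

  fromVec : A → ∀ {c} → Vec A c → ℕ → A
  fromVec d [] _ = d
  fromVec d (a ∷ _) zero = a
  fromVec d (_ ∷ u) (suc k) = fromVec d u k

  fromVec-prefix : ∀ d (w : ℕ → A) {c k} → k < c → fromVec d (prefix w c) k ≡ w k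
  fromVec-prefix d w {suc c} {zero} _ = refl
  fromVec-prefix d w {suc c} {suc k} (s≤s k<c) = fromVec-prefix d (w ∘ suc) k<c

  extend : (ℕ → A) → ℕ → A → ℕ → A
  extend u L a i with i ≟ L
  ... | yes _ = a
  ... | no _ = u i

  extend-agree : ∀ {u w : ℕ → A} {L a} → (∀ i → i < L → u i ≡ w i) → a ≡ w L →
                 ∀ i → i < suc L → extend u L a i ≡ w i
  extend-agree {L = L} agree a≡wL i i<1+L with i ≟ L
  ... | yes refl = a≡wL
  ... | no i≢L = agree i (≤∧≢⇒< (≤-pred i<1+L) i≢L)

allBelow? : {P : ℕ → Set} → Decidable P → ∀ v → Dec (∀ n → n < v → P n)
allBelow? P? v = map′ (λ all n → all {n}) (λ all {n} → all n) (allUpTo? P? v)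

allVectors? : ∀ {k} c {P : Vec (Fin k) c → Set} → Decidable P → Dec (∀ u → P u)
allVectors? zero P? = map′ (λ p → λ { [] → p }) (λ all → all []) (P? [])
allVectors? (suc c) P? = map′ (λ all → λ { (a ∷ u) → all a u }) (λ all a u → all (a ∷ u))
                                (all? λ a → allVectors? c λ u → P? (a ∷ u))

module _ {A : Set} (_≟_ : DecidableEquality A) where

  isSquareAt? : ∀ w i l → Dec (IsSquareAt w i l)
  isSquareAt? w i l = 1 ≤? l ×-dec allBelow? (λ k → w (i + k) ≟ w (i + l + k)) l

  squareFreeWithin? : ∀ N w → Dec (SquareFreeWithin N w)
  squareFreeWithin? N w = map′ unbounded bounded
    (allBelow? (λ i → allBelow? (λ l → ¬? (isSquareAt? w i l ×-dec i + l + l ≤? N)) N) N)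
    where
    unbounded : (∀ i → i < N → ∀ l → l < N → ¬ (IsSquareAt w i l × i + l + l ≤ N)) → SquareFreeWithin N w
    unbounded none i l sq@(1≤l , _) bound = none i (<-≤-trans i<i+l+l bound) l (<-≤-trans l<i+l+l bound) (sq , bound)
      where
      i<i+l+l : i < i + l + l
      i<i+l+l = <-≤-trans (m<m+n i 1≤l) (m≤m+n (i + l) l)
      l<i+l+l : l < i + l + l
      l<i+l+l = <-≤-trans (m<m+n l 1≤l) (subst (_≤ i + l + l) (+-comm l l) (+-monoˡ-≤ l (m≤n+m l i)))
    bounded : SquareFreeWithin N w → ∀ i → i < N → ∀ l → l < N → ¬ (IsSquareAt w i l × i + l + l ≤ N)
    bounded sf i _ l _ (sq , bound) = sf i l sq bound

  squareEndingAt? : ∀ w N → Dec (∃[ l ] l < N × IsSquareAt w (N ∸ (l + l)) l × l + l ≤ N)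
  squareEndingAt? w N = anyUpTo? (λ l → isSquareAt? w (N ∸ (l + l)) l ×-dec l + l ≤? N) N

-- Uniform morphisms

module UniformMorphism {A B : Set} (m : ℕ) .{{_ : NonZero m}} (h : A → ℕ → B) where

  -- h a is the block of a, read only at positions below m.
  image : (ℕ → A) → ℕ → B
  image t n = h (t (n / m)) (n % m)

  concat : A → A → ℕ → B
  concat a b p with p <? m
  ... | yes _ = h a p
  ... | no _ = h b (p ∸ m)

  [x+j*m]/m≡j : ∀ {x} j → x < m → (x + j * m) / m ≡ j
  [x+j*m]/m≡j {x} j x<m = begin
    (x + j * m) / m     ≡⟨ +-distrib-/-∣ʳ x (n∣m*n j) ⟩
    x / m + j * m / m   ≡⟨ cong₂ _+_ (m<n⇒m/n≡0 x<m) (m*n/n≡m j m) ⟩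
    j                   ∎
    where open ≡-Reasoning

  [x+j*m]%m≡x : ∀ {x} j → x < m → (x + j * m) % m ≡ x
  [x+j*m]%m≡x {x} j x<m = trans ([m+kn]%n≡m%n x j m) (m<n⇒m%n≡m x<m)

  image-block : ∀ t {x} j → x < m → image t (x + j * m) ≡ h (t j) x
  image-block t j x<m = cong₂ (λ a b → h (t a) b) ([x+j*m]/m≡j j x<m) ([x+j*m]%m≡x j x<m)

  image-drop : ∀ t j → image (drop j t) ≗ drop (j * m) (image t)
  image-drop t j x = begin
    h (t (j + x / m)) (x % m)   ≡⟨ cong₂ (λ a b → h (t a) b) (sym div) (sym (trans (cong (_% m) (+-comm (j * m) x)) ([m+kn]%n≡m%n x j m))) ⟩
    image t (j * m + x)         ∎
    where
    open ≡-Reasoning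
    div : (j * m + x) / m ≡ j + x / m
    div = trans (+-distrib-/-∣ˡ x (n∣m*n j)) (cong (_+ x / m) (m*n/n≡m j m))

  image-window : ∀ t n {k} → k < m → image t (n + k) ≡ concat (t (n / m)) (t (suc (n / m))) (n % m + k)
  image-window t n {k} k<m with n % m + k <? m
  ... | yes p<m = trans (cong (image t) n+k≡) (image-block t (n / m) p<m)
    where
    n+k≡ : n + k ≡ n % m + k + n / m * m
    n+k≡ = trans (cong (_+ k) (m≡m%n+[m/n]*n n m)) (reorder (n % m) (n / m * m) k)
      where reorder : ∀ a b c → a + b + c ≡ a + c + b
            reorder = solve-∀
  ... | no p≮m = trans (cong (image t) n+k≡) (image-block t (suc (n / m)) e<m)
    where
    e = n % m + k ∸ m
    e+m≡ : e + m ≡ n % m + k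
    e+m≡ = m∸n+n≡m (≮⇒≥ p≮m)
    e<m : e < m
    e<m = +-cancelʳ-< m e m (subst (_< m + m) (sym e+m≡) (+-mono-< (m%n<n n m) k<m))
    n+k≡ : n + k ≡ e + suc (n / m) * m
    n+k≡ = begin
      n + k                         ≡⟨ cong (_+ k) (m≡m%n+[m/n]*n n m) ⟩
      n % m + n / m * m + k         ≡⟨ reorder (n % m) (n / m * m) k ⟩
      n % m + k + n / m * m         ≡⟨ cong (_+ n / m * m) (sym e+m≡) ⟩
      e + m + n / m * m             ≡⟨ +-assoc e m (n / m * m) ⟩
      e + suc (n / m) * m           ∎
      where
      open ≡-Reasoning
      reorder : ∀ a b c → a + b + c ≡ a + c + b
      reorder = solve-∀

  Synchronizing : Set
  Synchronizing = ∀ a b c p → p < m → 0 < p → ¬ (∀ k → k < m → h c k ≡ concat a b (p + k))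

  InjectiveAt : ℕ → Set
  InjectiveAt pos = ∀ a a' → h a pos ≡ h a' pos → a ≡ a'

  ShortSquareFreeImage : ℕ → (ℕ → A) → Set
  ShortSquareFreeImage c v = ∀ s → s < m → ∀ l → l < m + m → s + l + l ≤ c * m → ¬ IsSquareAt (image v) s l

  -- The bound 5: a square starting at s < m with half-length l < 2m ends before 5m.
  record Conditions : Set where
    field
      synchronizing : Synchronizing
      position : ℕ
      position<m : position < m
      injectiveAt : InjectiveAt position
      shortSquareFree : ∀ c v → c ≤ 5 → SquareFreeWithin c v → ShortSquareFreeImage c v

  shortSquareFreeImage-prefix : ∀ d c v → ShortSquareFreeImage c (fromVec d (prefix v c)) → ShortSquareFreeImage c v
  shortSquareFreeImage-prefix d c v free s s<m l l<2m bound sq =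
    free s s<m l l<2m bound (isSquareAt-agree {w = image v} agree sq)
    where
    agree : ∀ x → x < s + l + l → image v x ≡ image (fromVec d (prefix v c)) x
    agree x x< = cong (λ a → h a (x % m)) (sym (fromVec-prefix d v {c} (m<n*o⇒m/o<n (<-≤-trans x< bound))))

  image-linkedWithin : {R : A → A → Set} {E : B → B → Set} →
                       (∀ a k → suc k < m → E (h a k) (h a (suc k))) →
                       (∀ a b → R a b → E (h a (m ∸ 1)) (h b 0)) →
                       ∀ {N} t → LinkedWithin R N t → LinkedWithin E (N * m) (image t)
  image-linkedWithin {E = E} internal junction {N} t linked n 1+n<N*m with suc (n % m) <? m
  ... | yes 1+s<m = subst₂ E (trans (sym (image-block t j s<m)) (cong (image t) (sym n≡s+j*m)))
                              (trans (sym (image-block t j 1+s<m)) (cong (image t ∘ suc) (sym n≡s+j*m)))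
                              (internal (t j) s 1+s<m)
    where
    j = n / m
    s = n % m
    s<m : s < m
    s<m = m%n<n n m
    n≡s+j*m : n ≡ s + j * m
    n≡s+j*m = m≡m%n+[m/n]*n n m
  ... | no 1+s≮m = subst₂ E (cong (λ x → h (t j) (x ∸ 1)) (sym 1+s≡m)) (trans (sym (image-block t (suc j) (>-nonZero⁻¹ m))) (cong (image t) (sym 1+n≡)))
                            (junction (t j) (t (suc j)) (linked j (*-cancelʳ-< m (suc j) N (subst (_< N * m) 1+n≡ 1+n<N*m))))
    where
    j = n / m
    s = n % m
    1+s≡m : suc s ≡ m
    1+s≡m = ≤-antisym (m%n<n n m) (≮⇒≥ 1+s≮m)
    1+n≡ : suc n ≡ suc j * m
    1+n≡ = trans (cong suc (m≡m%n+[m/n]*n n m)) (cong (_+ j * m) 1+s≡m)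

  image-linked : {R : A → A → Set} {E : B → B → Set} →
                 (∀ a k → suc k < m → E (h a k) (h a (suc k))) →
                 (∀ a b → R a b → E (h a (m ∸ 1)) (h b 0)) →
                 ∀ t → (∀ n → R (t n) (t (suc n))) → ∀ n → E (image t n) (image t (suc n))
  image-linked {R} {E} internal junction t linked n =
    image-linkedWithin {R = R} {E = E} internal junction {suc (suc n)} t (λ j _ → linked j) n (<-≤-trans (n<1+n (suc n)) (m≤m*n (suc (suc n)) m))

  block-position-after : ∀ i {p} → p < m → ∃[ j ] ∃[ e ] e < m × i + e ≡ p + j * m
  block-position-after i {p} p<m with i % m ≤? p
  ... | yes s≤p = let o , s+o≡p = m≤n⇒∃[o]m+o≡n s≤p in
    i / m , o , ≤-<-trans (m≤n+m o (i % m)) (subst (_< m) (sym s+o≡p) p<m) , (begin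
      i + o                       ≡⟨ cong (_+ o) (m≡m%n+[m/n]*n i m) ⟩
      i % m + i / m * m + o       ≡⟨ reorder (i % m) (i / m * m) o ⟩
      i % m + o + i / m * m       ≡⟨ cong (_+ i / m * m) s+o≡p ⟩
      p + i / m * m               ∎)
    where
    open ≡-Reasoning
    reorder : ∀ a b c → a + b + c ≡ a + c + b
    reorder = solve-∀
  ... | no s≰p = let o , s+o≡m = m≤n⇒∃[o]m+o≡n (<⇒≤ (m%n<n i m)) in
    suc (i / m) , o + p , subst (o + p <_) (trans (+-comm o (i % m)) s+o≡m) (+-monoʳ-< o (≰⇒> s≰p)) , (begin
      i + (o + p)                     ≡⟨ cong (_+ (o + p)) (m≡m%n+[m/n]*n i m) ⟩
      i % m + i / m * m + (o + p)     ≡⟨ reorder (i % m) (i / m * m) o p ⟩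
      p + (i % m + o + i / m * m)     ≡⟨ cong (λ x → p + (x + i / m * m)) s+o≡m ⟩
      p + suc (i / m) * m             ∎)
    where
    open ≡-Reasoning
    reorder : ∀ a b c d → a + b + (c + d) ≡ d + (a + c + b)
    reorder = solve-∀

  module _ (conditions : Conditions) where
    open Conditions conditions

    block-aligned : ∀ t n c → (∀ k → k < m → image t (n + k) ≡ h c k) → m ∣ n
    block-aligned t n c n⋯≡c with n % m in r≡
    ... | zero = m%n≡0⇒n∣m n m r≡
    ... | suc r = contradiction shifted (synchronizing (t (n / m)) (t (suc (n / m))) c (suc r) r<m (s≤s z≤n))
      where
      r<m : suc r < m
      r<m = subst (_< m) r≡ (m%n<n n m)
      shifted : ∀ k → k < m → h c k ≡ concat (t (n / m)) (t (suc (n / m))) (suc r + k)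
      shifted k k<m = trans (sym (n⋯≡c k k<m))
        (subst (λ x → image t (n + k) ≡ concat (t (n / m)) (t (suc (n / m))) (x + k)) r≡ (image-window t n k<m))

    -- The first complete block of the square's first half reappears l positions
    -- later; synchronization puts that copy on a block boundary.
    long-square-aligned : ∀ t {i l} → IsSquareAt (image t) i l → m + m ≤ l → m ∣ l
    long-square-aligned t {i} {l} (_ , eq) 2m≤l with block-position-after i {0} (>-nonZero⁻¹ m)
    ... | j , e , e<m , i+e≡j*m = ∣m+n∣m⇒∣n (block-aligned t (j * m + l) (t j) repeated) (n∣m*n j)
      where
      open ≡-Reasoning
      repeated : ∀ k → k < m → image t (j * m + l + k) ≡ h (t j) k
      repeated k k<m = begin
        image t (j * m + l + k)     ≡⟨ cong (λ x → image t (x + l + k)) i+e≡j*m ⟨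
        image t (i + e + l + k)     ≡⟨ cong (image t) (reorder i e l k) ⟩
        image t (i + l + (e + k))   ≡⟨ eq (e + k) (<-≤-trans (+-mono-< e<m k<m) 2m≤l) ⟨
        image t (i + (e + k))       ≡⟨ cong (image t) (trans (sym (+-assoc i e k)) (trans (cong (_+ k) i+e≡j*m) (+-comm (j * m) k))) ⟩
        image t (k + j * m)         ≡⟨ image-block t j k<m ⟩
        h (t j) k                   ∎
        where
        reorder : ∀ a b c d → a + b + c + d ≡ a + c + (b + d)
        reorder = solve-∀

    long-square-desubstitute : ∀ t {i L} → IsSquareAt (image t) i (L * m) → 1 ≤ L →
                               ∃[ j ] IsSquareAt t j L × j * m < i + m
    long-square-desubstitute t {i} {L} (_ , eq) 1≤L with block-position-after i position<m
    ... | j , e , e<m , i+e≡ = j , (1≤L , λ u u<L → injectiveAt _ _ (letters u u<L)) , j*m<i+m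
      where
      first : ∀ u → position + (j + u) * m ≡ i + (e + u * m)
      first u = trans (distribute position j u m) (trans (cong (_+ u * m) (sym i+e≡)) (+-assoc i e (u * m)))
        where distribute : ∀ p j u m → p + (j + u) * m ≡ p + j * m + u * m
              distribute = solve-∀
      second : ∀ u → i + L * m + (e + u * m) ≡ position + (j + L + u) * m
      second u = trans (regroup i L e u m) (trans (cong (_+ (L * m + u * m)) i+e≡) (distribute position j L u m))
        where regroup : ∀ i L e u m → i + L * m + (e + u * m) ≡ i + e + (L * m + u * m)
              regroup = solve-∀
              distribute : ∀ p j L u m → p + j * m + (L * m + u * m) ≡ p + (j + L + u) * m
              distribute = solve-∀
      letters : ∀ u → u < L → h (t (j + u)) position ≡ h (t (j + L + u)) position
      letters u u<L = begin
        h (t (j + u)) position                ≡⟨ image-block t (j + u) position<m ⟨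
        image t (position + (j + u) * m)      ≡⟨ cong (image t) (first u) ⟩
        image t (i + (e + u * m))             ≡⟨ eq (e + u * m) (<-≤-trans (+-monoˡ-< (u * m) e<m) (*-monoˡ-≤ m u<L)) ⟩
        image t (i + L * m + (e + u * m))     ≡⟨ cong (image t) (second u) ⟩
        image t (position + (j + L + u) * m)  ≡⟨ image-block t (j + L + u) position<m ⟩
        h (t (j + L + u)) position            ∎
        where open ≡-Reasoning
      j*m<i+m : j * m < i + m
      j*m<i+m = begin-strict
        j * m             ≤⟨ m≤n+m (j * m) position ⟩
        position + j * m  ≡⟨ i+e≡ ⟨
        i + e             <⟨ +-monoʳ-< i e<m ⟩
        i + m             ∎
        where open ≤-Reasoning

    short-square-absent : ∀ {N} t → SquareFreeWithin N t → ∀ {i l} → IsSquareAt (image t) i l →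
                          i + l + l ≤ N * m → l < m + m → ⊥
    short-square-absent {N} t sf {i} {l} sq i+2l≤N*m l<2m =
      shortSquareFree c (drop j t) (m⊓n≤m 5 (N ∸ j)) (squareFreeWithin-drop {w = t} j c j+c≤N sf)
                      s s<m l l<2m s+2l≤c*m square-in-window
      where
      open ≤-Reasoning
      j = i / m
      s = i % m
      c = 5 ⊓ (N ∸ j)
      s<m : s < m
      s<m = m%n<n i m
      i≡j*m+s : i ≡ j * m + s
      i≡j*m+s = trans (m≡m%n+[m/n]*n i m) (+-comm s (j * m))
      square-in-window : IsSquareAt (image (drop j t)) s l
      square-in-window = isSquareAt-agree {w = drop (j * m) (image t)} (λ k _ → sym (image-drop t j k))
                           (isSquareAt-drop {w = image t} (j * m) (subst (λ x → IsSquareAt (image t) x l) i≡j*m+s sq))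
      window-bound : s + l + l + j * m ≤ N * m
      window-bound = begin
        s + l + l + j * m   ≡⟨ reorder s l (j * m) ⟩
        j * m + s + l + l   ≡⟨ cong (λ x → x + l + l) i≡j*m+s ⟨
        i + l + l           ≤⟨ i+2l≤N*m ⟩
        N * m               ∎
        where reorder : ∀ a b c → a + b + b + c ≡ c + a + b + b
              reorder = solve-∀
      j≤N : j ≤ N
      j≤N = *-cancelʳ-≤ j N m (≤-trans (m≤n+m (j * m) (s + l + l)) window-bound)
      j+c≤N : j + c ≤ N
      j+c≤N = ≤-trans (+-monoʳ-≤ j (m⊓n≤n 5 (N ∸ j))) (≤-reflexive (m+[n∸m]≡n j≤N))
      s+2l≤5*m : s + l + l ≤ 5 * m
      s+2l≤5*m = begin
        s + l + l               ≤⟨ +-mono-≤ (+-mono-≤ (<⇒≤ s<m) (<⇒≤ l<2m)) (<⇒≤ l<2m) ⟩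
        m + (m + m) + (m + m)   ≡⟨ five m ⟩
        5 * m                   ∎
        where five : ∀ a → a + (a + a) + (a + a) ≡ 5 * a
              five = solve-∀
      s+2l≤c*m : s + l + l ≤ c * m
      s+2l≤c*m = subst (s + l + l ≤_) (sym (*-distribʳ-⊓ m 5 (N ∸ j)))
        (⊓-glb s+2l≤5*m (subst (s + l + l ≤_) (sym (*-distribʳ-∸ m N j)) (m+n≤o⇒m≤o∸n (s + l + l) window-bound)))

    image-squareFreeWithin : ∀ {N} t → SquareFreeWithin N t → SquareFreeWithin (N * m) (image t)
    image-squareFreeWithin {N} t sf i l sq i+2l≤N*m with l <? m + m
    ... | yes l<2m = short-square-absent t sf sq i+2l≤N*m l<2m
    ... | no l≮2m with long-square-aligned t sq (≮⇒≥ l≮2m)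
    ...   | divides L refl with long-square-desubstitute t sq (1≤L L (proj₁ sq))
      where
      1≤L : ∀ L → 1 ≤ L * m → 1 ≤ L
      1≤L (suc _) _ = s≤s z≤n
    ...     | j , square-in-t , j*m<i+m = sf j L square-in-t (≤-pred (*-cancelʳ-< m (j + L + L) (suc N) scaled))
      where
      open ≤-Reasoning
      scaled : (j + L + L) * m < suc N * m
      scaled = begin-strict
        (j + L + L) * m             ≡⟨ distribute j L m ⟩
        j * m + L * m + L * m       <⟨ +-monoˡ-< (L * m) (+-monoˡ-< (L * m) j*m<i+m) ⟩
        i + m + L * m + L * m       ≡⟨ reorder i m (L * m) ⟩
        m + (i + L * m + L * m)     ≤⟨ +-monoʳ-≤ m i+2l≤N*m ⟩
        suc N * m                   ∎
        where distribute : ∀ j L m → (j + L + L) * m ≡ j * m + L * m + L * m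
              distribute = solve-∀
              reorder : ∀ a b c → a + b + c + c ≡ b + (a + c + c)
              reorder = solve-∀

    image-squareFree : ∀ t → SquareFree t → SquareFree (image t)
    image-squareFree t sf = squareFreeWithin⇒squareFree {w = image t} λ N →
      squareFreeWithin-mono {w = image t} (m≤m*n N m) (image-squareFreeWithin t (squareFree⇒squareFreeWithin {w = t} N sf))

module FiniteUniformMorphism {n k : ℕ} (m : ℕ) .{{_ : NonZero m}} (h : Fin (suc n) → ℕ → Fin k) where
  open UniformMorphism m h

  synchronizing? : Dec Synchronizing
  synchronizing? = all? λ a → all? λ b → all? λ c → allBelow? (λ p → 0 <? p →-dec
                     ¬? (allBelow? (λ j → h c j ≟ᶠ concat a b (p + j)) m)) m

  injectiveAt? : ∀ pos → Dec (InjectiveAt pos)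
  injectiveAt? pos = all? λ a → all? λ a' → h a pos ≟ᶠ h a' pos →-dec a ≟ᶠ a'

  ShortSquareFreePrefixes : Set
  ShortSquareFreePrefixes = ∀ c → c < 6 → ∀ (u : Vec (Fin (suc n)) c) →
                            SquareFreeWithin c (fromVec zero u) → ShortSquareFreeImage c (fromVec zero u)

  shortSquareFreeImage? : ∀ c v → Dec (ShortSquareFreeImage c v)
  shortSquareFreeImage? c v =
    allBelow? (λ s → allBelow? (λ l → s + l + l ≤? c * m →-dec ¬? (isSquareAt? _≟ᶠ_ (image v) s l)) (m + m)) m

  shortSquareFreePrefixes? : Dec ShortSquareFreePrefixes
  shortSquareFreePrefixes? = allBelow? (λ c → allVectors? c λ u →
    squareFreeWithin? _≟ᶠ_ c (fromVec zero u) →-dec shortSquareFreeImage? c (fromVec zero u)) 6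

  conditions : ∀ pos → {True (pos <? m)} → {True synchronizing?} → {True (injectiveAt? pos)} →
               {True shortSquareFreePrefixes?} → Conditions
  conditions pos {pos<m} {sync} {inj} {short} = record
    { synchronizing = toWitness sync
    ; position = pos
    ; position<m = toWitness pos<m
    ; injectiveAt = toWitness inj
    ; shortSquareFree = λ c v c≤5 sf → shortSquareFreeImage-prefix zero c v
        (toWitness short c (s≤s c≤5) (prefix v c) (squareFreeWithin-agree (λ _ j<c → sym (fromVec-prefix zero v j<c)) sf))
    }

  internalEdges? : {E : Fin k → Fin k → Set} → (∀ x y → Dec (E x y)) →
                   Dec (∀ a j → suc j < m → E (h a j) (h a (suc j)))
  internalEdges? E? = all? λ a → map′ (λ edges j 1+j<m → edges j (<-trans (n<1+n j) 1+j<m) 1+j<m) (λ edges j _ → edges j)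
                                     (allBelow? (λ j → suc j <? m →-dec E? (h a j) (h a (suc j))) m)

  junctionEdges? : {R : Fin (suc n) → Fin (suc n) → Set} {E : Fin k → Fin k → Set} →
                   (∀ a b → Dec (R a b)) → (∀ x y → Dec (E x y)) →
                   Dec (∀ a b → R a b → E (h a (m ∸ 1)) (h b 0))
  junctionEdges? R? E? = all? λ a → all? λ b → R? a b →-dec E? (h a (m ∸ 1)) (h b 0)

-- Fixed points

scaling-induction : ∀ {m} → 1 < m → (P : ℕ → Set) → (∀ {M N} → M ≤ N → P N → P M) →
                    P 1 → (∀ N → P N → P (N * m)) → ∀ N → P N
scaling-induction {m} 1<m P down base step N = down (<⇒≤ (n<m^n N)) (powers N)
  where
  powers : ∀ k → P (m ^ k)
  powers zero = base
  powers (suc k) = subst P (*-comm (m ^ k) m) (step (m ^ k) (powers k))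
  n<m^n : ∀ k → k < m ^ k
  n<m^n zero = s≤s z≤n
  n<m^n (suc k) = ≤-<-trans (n<m^n k) (^-monoʳ-< m 1<m (n<1+n k))

module FixedPoint {A : Set} (m : ℕ) .{{_ : NonZero m}} (1<m : 1 < m)
                  (h : A → ℕ → A) (a : A) (h-a-0≡a : h a 0 ≡ a) where
  open UniformMorphism m h

  -- iterate r = hʳ(a); since h(a) starts with a, it is stable below r.
  iterate : ℕ → ℕ → A
  iterate zero _ = a
  iterate (suc r) = image (iterate r)

  iterate-0 : ∀ r → iterate r 0 ≡ a
  iterate-0 zero = refl
  iterate-0 (suc r) = trans (cong₂ (λ q x → h (iterate r q) x) (0/n≡0 m) (m<n⇒m%n≡m (>-nonZero⁻¹ m)))
                            (trans (cong (λ x → h x 0) (iterate-0 r)) h-a-0≡a)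

  iterate-stable : ∀ r r' {k} → k < r → k < r' → iterate r k ≡ iterate r' k
  iterate-stable (suc r) (suc r') {zero} _ _ = trans (iterate-0 (suc r)) (sym (iterate-0 (suc r')))
  iterate-stable (suc r) (suc r') {k@(suc _)} (s≤s k≤r) (s≤s k≤r') =
    cong (λ x → h x (k % m)) (iterate-stable r r' (<-≤-trans k/m<k k≤r) (<-≤-trans k/m<k k≤r'))
    where
    k/m<k : k / m < k
    k/m<k = m/n<m k m 1<m

  fixedPoint : ℕ → A
  fixedPoint k = iterate (suc k) k

  fixedPoint-image : image fixedPoint ≗ fixedPoint
  fixedPoint-image zero = cong (λ x → h x (0 % m)) (trans (cong (λ q → iterate (suc q) q) (0/n≡0 m)) (iterate-0 1))
  fixedPoint-image k@(suc _) = cong (λ x → h x (k % m)) (iterate-stable (suc (k / m)) k ≤-refl (m/n<m k m 1<m))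

  fixedPoint-squareFree : Conditions → SquareFree fixedPoint
  fixedPoint-squareFree conditions = squareFreeWithin⇒squareFree {w = fixedPoint}
    (scaling-induction 1<m (λ N → SquareFreeWithin N fixedPoint)
                       (squareFreeWithin-mono {w = fixedPoint}) (squareFreeWithin-1 {w = fixedPoint}) step)
    where
    step : ∀ N → SquareFreeWithin N fixedPoint → SquareFreeWithin (N * m) fixedPoint
    step N sf = squareFreeWithin-resp-≗ {w = image fixedPoint} fixedPoint-image
                                        (image-squareFreeWithin conditions fixedPoint sf)

  fixedPoint-linked : {E : A → A → Set} →
                      (∀ b k → suc k < m → E (h b k) (h b (suc k))) →
                      (∀ b c → E b c → E (h b (m ∸ 1)) (h c 0)) →
                      ∀ n → E (fixedPoint n) (fixedPoint (suc n))
  fixedPoint-linked {E} internal junction n =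
    scaling-induction 1<m (λ N → LinkedWithin E N fixedPoint) down (λ { _ (s≤s ()) }) step (suc (suc n)) n ≤-refl
    where
    down : ∀ {M N} → M ≤ N → LinkedWithin E N fixedPoint → LinkedWithin E M fixedPoint
    down M≤N linked j 1+j<M = linked j (<-≤-trans 1+j<M M≤N)
    step : ∀ N → LinkedWithin E N fixedPoint → LinkedWithin E (N * m) fixedPoint
    step N linked j 1+j<N*m = subst₂ E (fixedPoint-image j) (fixedPoint-image (suc j))
      (image-linkedWithin {R = E} {E = E} internal junction fixedPoint linked j 1+j<N*m)

-- Square-free walks on cycles

cycleAdj? : ∀ n .{{_ : NonZero n}} (a b : Fin n) → Dec (CycleAdj n a b)
cycleAdj? n a b = toℕ b ≟ (toℕ a + 1) % n ⊎-dec toℕ a ≟ (toℕ b + 1) % n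

PathAdj : ∀ {n} → Fin n → Fin n → Set
PathAdj a b = toℕ b ≡ suc (toℕ a) ⊎ toℕ a ≡ suc (toℕ b)

pathAdj? : ∀ {n} (a b : Fin n) → Dec (PathAdj a b)
pathAdj? a b = toℕ b ≟ suc (toℕ a) ⊎-dec toℕ a ≟ suc (toℕ b)

pathAdj⇒cycleAdj : ∀ {n} .{{_ : NonZero n}} {a b : Fin n} → PathAdj a b → CycleAdj n a b
pathAdj⇒cycleAdj {a = a} {b} = Sum.map (successor a b) (successor b a)
  where
  successor : ∀ {n} .{{_ : NonZero n}} (a b : Fin n) → toℕ b ≡ suc (toℕ a) → toℕ b ≡ (toℕ a + 1) % n
  successor {n} a b b≡1+a = trans b≡a+1 (sym (m<n⇒m%n≡m (subst (_< n) b≡a+1 (toℕ<n b))))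
    where
    b≡a+1 : toℕ b ≡ toℕ a + 1
    b≡a+1 = trans b≡1+a (+-comm 1 (toℕ a))

pathAdj-↑ˡ : ∀ {n} k {a b : Fin n} → PathAdj a b → PathAdj (a ↑ˡ k) (b ↑ˡ k)
pathAdj-↑ˡ k {a} {b} rewrite toℕ-↑ˡ a k | toℕ-↑ˡ b k = id

_!_ : List ℕ → ℕ → ℕ
[] ! _ = 0
(x ∷ _) ! zero = x
(_ ∷ xs) ! suc k = xs ! k

-- Leech's square-free morphism.
h3 : Fin 3 → ℕ → Fin 3
h3 a k = (row a ! k) mod 3
  where
  row : Fin 3 → List ℕ
  row zero             = 0 ∷ 1 ∷ 2 ∷ 1 ∷ 0 ∷ 2 ∷ 1 ∷ 2 ∷ 0 ∷ 1 ∷ 2 ∷ 1 ∷ 0 ∷ []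
  row (suc zero)       = 1 ∷ 2 ∷ 0 ∷ 2 ∷ 1 ∷ 0 ∷ 2 ∷ 0 ∷ 1 ∷ 2 ∷ 0 ∷ 2 ∷ 1 ∷ []
  row (suc (suc zero)) = 2 ∷ 0 ∷ 1 ∷ 0 ∷ 2 ∷ 1 ∷ 0 ∷ 1 ∷ 2 ∷ 0 ∷ 1 ∷ 0 ∷ 2 ∷ []

module H3 = FixedPoint 13 (s≤s (s≤s z≤n)) h3 zero refl

ternary : ℕ → Fin 3
ternary = H3.fixedPoint

ternary-squareFree : SquareFree ternary
ternary-squareFree = H3.fixedPoint-squareFree (FiniteUniformMorphism.conditions 13 h3 12)

ternary-adjacent-distinct : ∀ n → ternary n ≢ ternary (suc n)
ternary-adjacent-distinct = squareFree⇒adjacent-distinct {w = ternary} ternary-squareFree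

ternary-walk : IsGWord (C 3) ternary
ternary-walk n = distinct⇒adjacent _ _ (ternary-adjacent-distinct n)
  where
  distinct⇒adjacent : ∀ a b → a ≢ b → CycleAdj 3 a b
  distinct⇒adjacent = toWitness {a? = all? λ a → all? λ b → ¬? (a ≟ᶠ b) →-dec cycleAdj? 3 a b} _

h4 : Fin 4 → ℕ → Fin 4
h4 a k = (row a ! k) mod 4
  where
  row : Fin 4 → List ℕ
  row zero                   = 0 ∷ 1 ∷ 2 ∷ 3 ∷ 0 ∷ 3 ∷ 2 ∷ 1 ∷ 2 ∷ []
  row (suc zero)             = 3 ∷ 0 ∷ 1 ∷ 0 ∷ 3 ∷ 0 ∷ 1 ∷ 2 ∷ 1 ∷ []
  row (suc (suc zero))       = 0 ∷ 3 ∷ 2 ∷ 3 ∷ 0 ∷ 3 ∷ 2 ∷ 1 ∷ 2 ∷ []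
  row (suc (suc (suc zero))) = 3 ∷ 2 ∷ 1 ∷ 0 ∷ 3 ∷ 0 ∷ 1 ∷ 2 ∷ 1 ∷ []

module H4 = FixedPoint 9 (s≤s (s≤s z≤n)) h4 zero refl

C4-word : ℕ → Fin 4
C4-word = H4.fixedPoint

C4-word-squareFree : SquareFree C4-word
C4-word-squareFree = H4.fixedPoint-squareFree (FiniteUniformMorphism.conditions 9 h4 1)

C4-word-walk : IsGWord (C 4) C4-word
C4-word-walk = H4.fixedPoint-linked (toWitness {a? = internalEdges? (cycleAdj? 4)} _)
                                    (toWitness {a? = junctionEdges? (cycleAdj? 4) (cycleAdj? 4)} _)
  where open FiniteUniformMorphism 9 h4

h5 : Fin 3 → ℕ → Fin 5
h5 a k = (row a ! k) mod 5
  where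
  row : Fin 3 → List ℕ
  row zero             = 0 ∷ 1 ∷ 2 ∷ 3 ∷ 4 ∷ 3 ∷ 2 ∷ 1 ∷ []
  row (suc zero)       = 0 ∷ 1 ∷ 2 ∷ 3 ∷ 2 ∷ 1 ∷ 0 ∷ 4 ∷ []
  row (suc (suc zero)) = 0 ∷ 1 ∷ 2 ∷ 1 ∷ 0 ∷ 4 ∷ 3 ∷ 4 ∷ []

module H5 = UniformMorphism 8 h5

C5-word : ℕ → Fin 5
C5-word = H5.image ternary

C5-word-squareFree : SquareFree C5-word
C5-word-squareFree = H5.image-squareFree (FiniteUniformMorphism.conditions 8 h5 4) ternary ternary-squareFree

C5-word-walk : IsGWord (C 5) C5-word
C5-word-walk = H5.image-linked {R = _≢_} {E = CycleAdj 5}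
  (toWitness {a? = internalEdges? (cycleAdj? 5)} _)
  (toWitness {a? = junctionEdges? (λ a b → ¬? (a ≟ᶠ b)) (cycleAdj? 5)} _)
  ternary ternary-adjacent-distinct
  where open FiniteUniformMorphism 8 h5

h6 : Fin 3 → ℕ → Fin 6
h6 a k = (row a ! k) mod 6
  where
  row : Fin 3 → List ℕ
  row zero             = 0 ∷ 1 ∷ 2 ∷ 3 ∷ 2 ∷ 1 ∷ 2 ∷ 3 ∷ 4 ∷ 5 ∷ 4 ∷ 3 ∷ 2 ∷ 1 ∷ []
  row (suc zero)       = 0 ∷ 1 ∷ 2 ∷ 3 ∷ 4 ∷ 3 ∷ 2 ∷ 3 ∷ 4 ∷ 5 ∷ 4 ∷ 3 ∷ 2 ∷ 1 ∷ []
  row (suc (suc zero)) = 0 ∷ 1 ∷ 2 ∷ 3 ∷ 4 ∷ 5 ∷ 4 ∷ 3 ∷ 2 ∷ 1 ∷ 2 ∷ 3 ∷ 2 ∷ 1 ∷ []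

module H6 = UniformMorphism 14 h6

P6-word : ℕ → Fin 6
P6-word = H6.image ternary

P6-word-squareFree : SquareFree P6-word
P6-word-squareFree = H6.image-squareFree (FiniteUniformMorphism.conditions 14 h6 5) ternary ternary-squareFree

P6-word-walk : ∀ n → PathAdj (P6-word n) (P6-word (suc n))
P6-word-walk = H6.image-linked {R = _≢_} {E = PathAdj}
  (toWitness {a? = internalEdges? pathAdj?} _)
  (toWitness {a? = junctionEdges? (λ a b → ¬? (a ≟ᶠ b)) pathAdj?} _)
  ternary ternary-adjacent-distinct
  where open FiniteUniformMorphism 14 h6

-- Three colours do not suffice on C₄

module WalkSearch (G : Graph) (neighbours : Fin (size G) → List (Fin (size G))) {k} (φ : Fin (size G) → Fin k) where

  -- doomed f u L v: every walk whose colours below L are u and which is at v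
  -- at step L has a square among its first L + f letters.
  doomed : ℕ → (ℕ → Fin k) → ℕ → Fin (size G) → Bool
  doomed zero _ _ _ = false
  doomed (suc f) u L v with squareEndingAt? _≟ᶠ_ (extend u L (φ v)) (suc L)
  ... | yes _ = true
  ... | no _ = all (doomed f (extend u L (φ v)) (suc L)) (neighbours v)

  doomed-sound : (∀ a b → Adj G a b → b ∈ neighbours a) →
                 ∀ f u L w → IsGWord G w → (∀ i → i < L → u i ≡ φ (w i)) →
                 T (doomed f u L (w L)) → ¬ SquareFree (φ ∘ w)
  doomed-sound complete (suc f) u L w walk agree doom sf with squareEndingAt? _≟ᶠ_ (extend u L (φ (w L))) (suc L)
  ... | yes (l , _ , square , l+l≤1+L) = sf (suc L ∸ (l + l) , l , isSquareAt-agree {w = extend u L (φ (w L))} agree′ square)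
    where
    agree′ : ∀ i → i < suc L ∸ (l + l) + l + l → extend u L (φ (w L)) i ≡ φ (w i)
    agree′ i i< = extend-agree agree refl i (subst (i <_) (trans (+-assoc (suc L ∸ (l + l)) l l) (m∸n+n≡m l+l≤1+L)) i<)
  ... | no _ = doomed-sound complete f (extend u L (φ (w L))) (suc L) w walk (extend-agree agree refl)
                            (All.lookup (all⁺ _ _ doom) (complete _ _ (walk L))) sf

cycle-neighbours : ∀ n .{{_ : NonZero n}} → Fin n → List (Fin n)
cycle-neighbours n a = (toℕ a + 1) mod n ∷ (toℕ a + (n ∸ 1)) mod n ∷ []

C4-not-3-achievable : ¬ Achievable (C 4) 3
C4-not-3-achievable (w , walk , φ , sf) =
  doomed-sound (lookup (tabulate φ)) neighbours-complete 16 (λ _ → zero) 0 w walk (λ _ ())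
               (every-walk-doomed (tabulate φ) (w 0))
               (squareFree-resp-≗ {w = φ ∘ w} (λ i → sym (lookup∘tabulate φ (w i))) sf)
  where
  open WalkSearch (C 4) (cycle-neighbours 4)
  neighbours-complete : ∀ a b → CycleAdj 4 a b → b ∈ cycle-neighbours 4 a
  neighbours-complete = toWitness {a? = all? λ a → all? λ b → cycleAdj? 4 a b →-dec DecMembership._∈?_ _≟ᶠ_ b (cycle-neighbours 4 a)} _
  every-walk-doomed : ∀ u v → T (doomed (lookup u) 16 (λ _ → zero) 0 v)
  every-walk-doomed = toWitness {a? = allVectors? 4 λ u → all? λ v → T? (doomed (lookup u) 16 (λ _ → zero) 0 v)} _

cycle-squareFree-walk : (n : ℕ) → .{{_ : NonZero n}} → 3 ≤ n →
                        Σ (ℕ → Fin n) λ w → IsGWord (C n) w × SquareFree w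
cycle-squareFree-walk 1 (s≤s ())
cycle-squareFree-walk 2 (s≤s (s≤s ()))
cycle-squareFree-walk 3 _ = ternary , ternary-walk , ternary-squareFree
cycle-squareFree-walk 4 _ = C4-word , C4-word-walk , C4-word-squareFree
cycle-squareFree-walk 5 _ = C5-word , C5-word-walk , C5-word-squareFree
cycle-squareFree-walk (suc (suc (suc (suc (suc (suc k)))))) _ =
  (λ i → P6-word i ↑ˡ k) ,
  (λ i → pathAdj⇒cycleAdj (pathAdj-↑ˡ k (P6-word-walk i))) ,
  squareFree-map (λ {a} {b} → ↑ˡ-injective k a b) {w = P6-word} P6-word-squareFree

squareFree-walk⇒achievable : ∀ G {w} → IsGWord G w → SquareFree w → Achievable G (size G)
squareFree-walk⇒achievable G walk sf = _ , walk , id , sf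

not-achievable-below-3 : ∀ G m → m < 3 → ¬ Achievable G m
not-achievable-below-3 G m m<3 (w , _ , φ , sf) = <⇒≱ m<3 (squareFree⇒3≤size (φ ∘ w) sf)

lemma9 : ((n : ℕ) → .{{_ : NonZero n}} → 3 ≤ n →
              Σ (ℕ → Fin n) λ w → IsGWord (C n) w × SquareFree w)
           × GammaIs (C 3) 3 × GammaIs (C 4) 4
lemma9 = cycle-squareFree-walk ,
         (squareFree-walk⇒achievable (C 3) ternary-walk ternary-squareFree , not-achievable-below-3 (C 3)) ,
         (squareFree-walk⇒achievable (C 4) C4-word-walk C4-word-squareFree , C4-below-4)
  where
  C4-below-4 : ∀ m → m < 4 → ¬ Achievable (C 4) m
  C4-below-4 m m<4 with m ≟ 3
  ... | yes refl = C4-not-3-achievable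
  ... | no m≢3 = not-achievable-below-3 (C 4) m (≤∧≢⇒< (≤-pred m<4) m≢3)
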